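{- For all integers $k\geq3$ and $n\geq1$, the $n$th second $k$-gonal number $\frac{n}{2}\big((k-2)n+(k-4)\big)$ equals the number of $(k-3)$-box paths of size $n+1$ with exactly two long ascents.
   Context: A skew Dyck path is a word $w$ over $\{U,D,L\}$ such that: $w$ contains neither $UL$ nor $LU$ as a contiguous subword; the number of $U$s equals the total number of $D$s and $L$s; and in every prefix the total number of $D$s and $L$s is at most the number of $U$s. Its semilength is its number of $U$s. A factor is a contiguous subword; $X^{m}$ denotes $m$ consecutive copies of $X$. For $k\geq1$, a $k$-box path of size $n$ is a skew Dyck path of semilength $(k+2)n-1$ containing exactly $n$ occurrences of the factor $UD^{k}L$. By convention, a $0$-box path of size $n$ is the word obtained from a Dyck path (word in $U,D$) of semilength $n-1$ by replacing each $D$ with $ULD$ and appending $UL$ at the end (so $0$-box paths of size $n$ correspond bijectively to Dyck paths of semilength $n-1$; their long ascents correspond to the peaks, i.e. $UD$-factors, of the Dyck path). An ascent is a maximal run of consecutive $U$s; a long ascent is an ascent consisting of at least two $U$s. The second $k$-gonal numbers are obtained from the $k$-gonal number formula $\frac{n}{2}((k-2)n-(k-4))$ by replacing $n$ with $-n$. -}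

module Defs where

open import Data.Nat using (ℕ; zero; suc; _+_; _*_; _∸_; _≡ᵇ_; _<ᵇ_)
open import Data.Bool using (Bool; true; false; _∧_; not; if_then_else_)
open import Data.List using (List; []; _∷_; _++_; map; concatMap; filterᵇ; length; replicate)

data Step : Set where
  U D L : Step

Word : Set
Word = List Step

words : ℕ → List Word
words zero = [] ∷ []
words (suc n) = concatMap (λ w → (U ∷ w) ∷ (D ∷ w) ∷ (L ∷ w) ∷ []) (words n)

noULLU : Word → Bool
noULLU (U ∷ L ∷ w) = false
noULLU (L ∷ U ∷ w) = false
noULLU (x ∷ w) = noULLU w
noULLU [] = true

balanced : ℕ → Word → Bool
balanced zero [] = true
balanced (suc _) [] = false
balanced h (U ∷ w) = balanced (suc h) w
balanced zero (D ∷ w) = false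
balanced (suc h) (D ∷ w) = balanced h w
balanced zero (L ∷ w) = false
balanced (suc h) (L ∷ w) = balanced h w

isSkewDyck : Word → Bool
isSkewDyck w = noULLU w ∧ balanced 0 w

noL : Word → Bool
noL [] = true
noL (L ∷ w) = false
noL (_ ∷ w) = noL w

isDyck : Word → Bool
isDyck w = noL w ∧ balanced 0 w

_=ˢ_ : Step → Step → Bool
U =ˢ U = true
D =ˢ D = true
L =ˢ L = true
_ =ˢ _ = false

isPrefix : Word → Word → Bool
isPrefix [] _ = true
isPrefix (x ∷ p) [] = false
isPrefix (x ∷ p) (y ∷ w) = (x =ˢ y) ∧ isPrefix p w

occurrences : Word → Word → ℕ
occurrences p [] = if isPrefix p [] then 1 else 0
occurrences p (x ∷ w) = (if isPrefix p (x ∷ w) then 1 else 0) + occurrences p w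

boxFactor : ℕ → Word
boxFactor k = U ∷ replicate k D ++ (L ∷ [])

-- 0-box convention: D ↦ ULD, then append UL
zeroBoxOf : Word → Word
zeroBoxOf w = concatMap (λ { D → U ∷ L ∷ D ∷ [] ; x → x ∷ [] }) w ++ (U ∷ L ∷ [])

boxPaths : ℕ → ℕ → List Word
boxPaths zero m = map zeroBoxOf (filterᵇ isDyck (words (2 * (m ∸ 1))))
boxPaths (suc j) m =
  filterᵇ (λ w → isSkewDyck w ∧ (occurrences (boxFactor (suc j)) w ≡ᵇ m))
          (words (2 * ((suc j + 2) * m ∸ 1)))

longAscentsFrom : ℕ → Word → ℕ
longAscentsFrom r [] = if 1 <ᵇ r then 1 else 0
longAscentsFrom r (U ∷ w) = longAscentsFrom (suc r) w
longAscentsFrom r (_ ∷ w) = (if 1 <ᵇ r then 1 else 0) + longAscentsFrom 0 w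

longAscents : Word → ℕ
longAscents = longAscentsFrom 0

countTwoLong : ℕ → ℕ → ℕ
countTwoLong k m = length (filterᵇ (λ w → longAscents w ≡ᵇ 2) (boxPaths k m))

module Submission where

-- The conditions defining the counted words (skew Dyck, number of box factors, number of long
-- ascents) can be checked letter by letter by a deterministic automaton, so the number of words
-- of length N + 1 accepted from a configuration is the sum of the numbers of words of length N
-- accepted from its successors; the theorem follows by solving these recurrences.
--
-- For k = 3 the 0-box image of a Dyck path has one long ascent per peak, and there are
-- n(n - 1)/2 Dyck paths of semilength n with two peaks.
--
-- For k ≥ 4 put J = k - 3. A box U D^J L takes J + 1 down-steps and, since LU is forbidden,
-- a further down-step must come before the next box, so a path with m boxes has semilength
-- at least (J + 2)m - 1: J-box paths are the paths of least length. Carried along as an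
-- invariant of the automaton, this length budget cuts off every branch that wastes a step,
-- and a J-box path is U^a₁ D^J L D U^a₂ D^J L D ⋯ U^aₘ D^J L. If a₁ and aᵢ are its two long
-- ascents, the heights allow (J + 1)(m - i + 1) - 1 values of a₁; summing over 2 ≤ i ≤ m gives
-- n((J + 1)n + J - 1)/2 with n = m - 1.

open import Defs
open import Data.Nat using (ℕ; zero; suc; _+_; _*_; _∸_; _≤_; _<_; z≤n; s≤s; _≡ᵇ_; _<ᵇ_; _≤ᵇ_)
open import Data.Nat.Properties
open import Data.Nat.Tactic.RingSolver using (solve-∀)
open import Data.Bool using (Bool; true; false; _∧_; if_then_else_)
open import Data.Bool.Properties using (∧-zeroʳ; ∧-identityʳ)
open import Data.List using (List; []; _∷_; _++_; map; concatMap; filterᵇ; length; replicate)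
open import Data.Maybe using (Maybe; just; nothing; maybe′)
import Data.Maybe as Maybe
open import Data.Maybe.Properties using (maybe′-map)
open import Data.Product using (_×_; _,_)
open import Data.Sum using (inj₁; inj₂)
open import Data.Unit using (⊤; tt)
open import Data.Empty using (⊥; ⊥-elim)
open import Function using (id)
open import Relation.Nullary using (Dec; yes; no)
open import Relation.Binary.Definitions using (tri<; tri≈; tri>)
open import Relation.Binary.PropositionalEquality
  using (_≡_; _≢_; refl; sym; trans; cong; cong₂; subst; subst₂; module ≡-Reasoning)

𝟙 : Bool → ℕ
𝟙 true = 1
𝟙 false = 0

≡ᵇ-refl : ∀ n → (n ≡ᵇ n) ≡ true
≡ᵇ-refl zero = refl
≡ᵇ-refl (suc n) = ≡ᵇ-refl n

≢⇒≡ᵇ-false : ∀ m n → m ≢ n → (m ≡ᵇ n) ≡ false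
≢⇒≡ᵇ-false zero zero m≢n = ⊥-elim (m≢n refl)
≢⇒≡ᵇ-false zero (suc n) _ = refl
≢⇒≡ᵇ-false (suc m) zero _ = refl
≢⇒≡ᵇ-false (suc m) (suc n) m≢n = ≢⇒≡ᵇ-false m n (λ m≡n → m≢n (cong suc m≡n))

≤⇒≤ᵇ-true : ∀ {m n} → m ≤ n → (m ≤ᵇ n) ≡ true
≤⇒≤ᵇ-true {m} {n} m≤n with m ≤ᵇ n | ≤⇒≤ᵇ m≤n
... | true | _ = refl

>⇒≤ᵇ-false : ∀ {m n} → n < m → (m ≤ᵇ n) ≡ false
>⇒≤ᵇ-false {m} {n} n<m with m ≤ᵇ n | ≤ᵇ⇒≤ m n
... | false | _ = refl
... | true | m≤n = ⊥-elim (<⇒≱ n<m (m≤n tt))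

≡ᵇ-+ˡ : ∀ k m n → (k + m ≡ᵇ k + n) ≡ (m ≡ᵇ n)
≡ᵇ-+ˡ zero m n = refl
≡ᵇ-+ˡ (suc k) m n = ≡ᵇ-+ˡ k m n

≤ᵇ-split : ∀ m n → 𝟙 (suc m ≤ᵇ n) + 𝟙 (m ≡ᵇ n) ≡ 𝟙 (m ≤ᵇ n)
≤ᵇ-split zero zero = refl
≤ᵇ-split zero (suc n) = refl
≤ᵇ-split (suc m) zero = refl
≤ᵇ-split (suc m) (suc n) = trans (≤ᵇ-split m n) (cong 𝟙 (sym (<ᵇ-suc m n)))
  where
  <ᵇ-suc : ∀ m n → (m <ᵇ suc n) ≡ (m ≤ᵇ n)
  <ᵇ-suc zero n = refl
  <ᵇ-suc (suc m) n = refl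

+-suc-suc : ∀ m n → 2 + (m + n) ≡ suc m + suc n
+-suc-suc m n = cong suc (sym (+-suc m n))

false≢true : false ≢ true
false≢true ()

∧-false-∧ : ∀ a b → (a ∧ false) ∧ b ≡ false
∧-false-∧ a b = cong (_∧ b) (∧-zeroʳ a)

∧-maybe′ : ∀ {A : Set} a (f : A → Bool) m → a ∧ maybe′ f false m ≡ maybe′ (λ x → a ∧ f x) false m
∧-maybe′ a f nothing = ∧-zeroʳ a
∧-maybe′ a f (just x) = refl

-- Finite sums

sumFrom : (ℕ → ℕ) → ℕ → ℕ → ℕ
sumFrom f a zero = 0
sumFrom f a (suc n) = f a + sumFrom f (suc a) n

sumFrom-+ : ∀ f g a n → sumFrom (λ x → f x + g x) a n ≡ sumFrom f a n + sumFrom g a n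
sumFrom-+ f g a zero = refl
sumFrom-+ f g a (suc n) =
  trans (cong (f a + g a +_) (sumFrom-+ f g (suc a) n)) (interchange (f a) (g a) (sumFrom f (suc a) n) (sumFrom g (suc a) n))
  where
  interchange : ∀ a b c d → a + b + (c + d) ≡ a + c + (b + d)
  interchange = solve-∀

sumFrom-++ : ∀ f a m n → sumFrom f a (m + n) ≡ sumFrom f a m + sumFrom f (m + a) n
sumFrom-++ f a zero n = refl
sumFrom-++ f a (suc m) n =
  trans (cong (f a +_) (trans (sumFrom-++ f (suc a) m n) (cong (λ b → sumFrom f (suc a) m + sumFrom f b n) (+-suc m a))))
        (sym (+-assoc (f a) (sumFrom f (suc a) m) (sumFrom f (suc (m + a)) n)))

sumFrom-vanishes : ∀ f a n → (∀ x → a ≤ x → x < a + n → f x ≡ 0) → sumFrom f a n ≡ 0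
sumFrom-vanishes f a zero _ = refl
sumFrom-vanishes f a (suc n) f≡0 = cong₂ _+_
  (f≡0 a ≤-refl (m<m+n a (s≤s z≤n)))
  (sumFrom-vanishes f (suc a) n (λ x a<x x<a+n → f≡0 x (<⇒≤ a<x) (subst (x <_) (sym (+-suc a n)) x<a+n)))

sumFrom-shift : ∀ f k a n → sumFrom f (k + a) n ≡ sumFrom (λ x → f (k + x)) a n
sumFrom-shift f k a zero = refl
sumFrom-shift f k a (suc n) =
  cong (f (k + a) +_) (trans (cong (λ b → sumFrom f b n) (sym (+-suc k a))) (sumFrom-shift f k (suc a) n))

sumFrom-cong : ∀ {f g} a n → (∀ x → a ≤ x → f x ≡ g x) → sumFrom f a n ≡ sumFrom g a n
sumFrom-cong a zero _ = refl
sumFrom-cong a (suc n) f≡g = cong₂ _+_ (f≡g a ≤-refl) (sumFrom-cong (suc a) n (λ x a<x → f≡g x (<⇒≤ a<x)))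

sumFrom-indicator : ∀ T a n → a ≤ T → T ≤ a + n → sumFrom (λ y → 𝟙 (suc y ≤ᵇ T)) a n + a ≡ T
sumFrom-indicator T a zero a≤T T≤a+0 = ≤-antisym a≤T (≤-trans T≤a+0 (≤-reflexive (+-identityʳ a)))
sumFrom-indicator T a (suc n) a≤T T≤a+n with m≤n⇒m<n∨m≡n a≤T
... | inj₁ a<T rewrite ≤⇒≤ᵇ-true a<T =
  trans (sym (+-suc _ a)) (sumFrom-indicator T (suc a) n a<T (≤-trans T≤a+n (≤-reflexive (+-suc a n))))
... | inj₂ refl rewrite >⇒≤ᵇ-false (n<1+n a) =
  cong (_+ a) (sumFrom-vanishes _ (suc a) n (λ x a<x _ → cong 𝟙 (>⇒≤ᵇ-false (s≤s (<⇒≤ a<x)))))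

sumFrom-id-closed : ∀ h c → 2 * sumFrom id h c + c ≡ c * (2 * h + c)
sumFrom-id-closed h zero = refl
sumFrom-id-closed h (suc c) = begin
  2 * (h + sumFrom id (suc h) c) + suc c     ≡⟨ regroup h (sumFrom id (suc h) c) c ⟩
  2 * h + 1 + (2 * sumFrom id (suc h) c + c) ≡⟨ cong (2 * h + 1 +_) (sumFrom-id-closed (suc h) c) ⟩
  2 * h + 1 + c * (2 * suc h + c)             ≡⟨ expand h c ⟩
  suc c * (2 * h + suc c)                     ∎
  where
  open ≡-Reasoning
  regroup : ∀ h s c → 2 * (h + s) + suc c ≡ 2 * h + 1 + (2 * s + c)
  regroup = solve-∀
  expand : ∀ h c → 2 * h + 1 + c * (2 * suc h + c) ≡ suc c * (2 * h + suc c)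
  expand = solve-∀

-- Counting words by their first letter

module _ {A : Set} where

  countᵇ : (A → Bool) → List A → ℕ
  countᵇ P xs = length (filterᵇ P xs)

  countᵇ-∷ : ∀ P x xs → countᵇ P (x ∷ xs) ≡ 𝟙 (P x) + countᵇ P xs
  countᵇ-∷ P x xs with P x
  ... | true = refl
  ... | false = refl

  countᵇ-cong : ∀ {P Q} → (∀ x → P x ≡ Q x) → ∀ xs → countᵇ P xs ≡ countᵇ Q xs
  countᵇ-cong e [] = refl
  countᵇ-cong {P} {Q} e (x ∷ xs) = begin
    countᵇ P (x ∷ xs)       ≡⟨ countᵇ-∷ P x xs ⟩
    𝟙 (P x) + countᵇ P xs   ≡⟨ cong₂ _+_ (cong 𝟙 (e x)) (countᵇ-cong e xs) ⟩
    𝟙 (Q x) + countᵇ Q xs   ≡⟨ countᵇ-∷ Q x xs ⟨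
    countᵇ Q (x ∷ xs)       ∎
    where open ≡-Reasoning

  countᵇ-filterᵇ : ∀ P Q xs → countᵇ P (filterᵇ Q xs) ≡ countᵇ (λ x → Q x ∧ P x) xs
  countᵇ-filterᵇ P Q [] = refl
  countᵇ-filterᵇ P Q (x ∷ xs) with Q x | countᵇ-∷ (λ y → Q y ∧ P y) x xs
  ... | false | e = trans (countᵇ-filterᵇ P Q xs) (sym e)
  ... | true | e = trans (countᵇ-∷ P x _) (trans (cong (𝟙 (P x) +_) (countᵇ-filterᵇ P Q xs)) (sym e))

countᵇ-map : ∀ {A B : Set} (P : A → Bool) (f : B → A) xs → countᵇ P (map f xs) ≡ countᵇ (λ x → P (f x)) xs
countᵇ-map P f [] = refl
countᵇ-map P f (x ∷ xs) = begin
  countᵇ P (f x ∷ map f xs)                ≡⟨ countᵇ-∷ P (f x) (map f xs) ⟩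
  𝟙 (P (f x)) + countᵇ P (map f xs)        ≡⟨ cong (𝟙 (P (f x)) +_) (countᵇ-map P f xs) ⟩
  𝟙 (P (f x)) + countᵇ (λ y → P (f y)) xs  ≡⟨ countᵇ-∷ (λ y → P (f y)) x xs ⟨
  countᵇ (λ y → P (f y)) (x ∷ xs)          ∎
    where open ≡-Reasoning

countᵇ-by-first-letter : ∀ (P : Word → Bool) ws →
  countᵇ P (concatMap (λ w → (U ∷ w) ∷ (D ∷ w) ∷ (L ∷ w) ∷ []) ws) ≡
  countᵇ (λ w → P (U ∷ w)) ws + (countᵇ (λ w → P (D ∷ w)) ws + countᵇ (λ w → P (L ∷ w)) ws)
countᵇ-by-first-letter P [] = refl
countᵇ-by-first-letter P (w ∷ ws) = begin
  countᵇ P ((U ∷ w) ∷ (D ∷ w) ∷ (L ∷ w) ∷ rest)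
    ≡⟨ trans (countᵇ-∷ P _ _) (cong (u +_) (trans (countᵇ-∷ P _ _) (cong (d +_) (countᵇ-∷ P _ _)))) ⟩
  u + (d + (l + countᵇ P rest))
    ≡⟨ cong (λ n → u + (d + (l + n))) (countᵇ-by-first-letter P ws) ⟩
  u + (d + (l + (countᵇ Pu ws + (countᵇ Pd ws + countᵇ Pl ws))))
    ≡⟨ interleave u d l _ _ _ ⟩
  (u + countᵇ Pu ws) + ((d + countᵇ Pd ws) + (l + countᵇ Pl ws))
    ≡⟨ sym (cong₂ _+_ (countᵇ-∷ Pu w ws) (cong₂ _+_ (countᵇ-∷ Pd w ws) (countᵇ-∷ Pl w ws))) ⟩
  countᵇ Pu (w ∷ ws) + (countᵇ Pd (w ∷ ws) + countᵇ Pl (w ∷ ws)) ∎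
  where
  open ≡-Reasoning
  rest : List Word
  rest = concatMap (λ v → (U ∷ v) ∷ (D ∷ v) ∷ (L ∷ v) ∷ []) ws
  Pu Pd Pl : Word → Bool
  Pu v = P (U ∷ v)
  Pd v = P (D ∷ v)
  Pl v = P (L ∷ v)
  u d l : ℕ
  u = 𝟙 (Pu w)
  d = 𝟙 (Pd w)
  l = 𝟙 (Pl w)
  interleave : ∀ a b c x y z → a + (b + (c + (x + (y + z)))) ≡ a + x + (b + y + (c + z))
  interleave = solve-∀

#words : ℕ → (Word → Bool) → ℕ
#words N P = countᵇ P (words N)

#words-zero : ∀ P → #words 0 P ≡ 𝟙 (P [])
#words-zero P with P []
... | true = refl
... | false = refl

#words-suc : ∀ N P → #words (suc N) P ≡
  #words N (λ w → P (U ∷ w)) + (#words N (λ w → P (D ∷ w)) + #words N (λ w → P (L ∷ w)))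
#words-suc N P = countᵇ-by-first-letter P (words N)

#words-cong : ∀ N {P Q} → (∀ w → P w ≡ Q w) → #words N P ≡ #words N Q
#words-cong N e = countᵇ-cong e (words N)

#words-none : ∀ N P → (∀ w → length w ≡ N → P w ≡ false) → #words N P ≡ 0
#words-none zero P none = trans (#words-zero P) (cong 𝟙 (none [] refl))
#words-none (suc N) P none = begin
  #words (suc N) P                                   ≡⟨ #words-suc N P ⟩
  #words N (λ w → P (U ∷ w)) + (#words N (λ w → P (D ∷ w)) + #words N (λ w → P (L ∷ w)))
    ≡⟨ cong₂ _+_ (none-after U) (cong₂ _+_ (none-after D) (none-after L)) ⟩
  0                                                  ∎
  where
  open ≡-Reasoning
  none-after : ∀ x → #words N (λ w → P (x ∷ w)) ≡ 0
  none-after x = #words-none N _ (λ w e → none (x ∷ w) (cong suc e))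

module Automaton {S : Set} (accepts : S → Word → Bool) (step : S → Step → Maybe S)
  (accepts-∷ : ∀ s x w → accepts s (x ∷ w) ≡ maybe′ (λ s′ → accepts s′ w) false (step s x)) where

  -- Opaque, so that Agda can recover s from #[ N ] just s when unifying.
  opaque
    #accepted : ℕ → S → ℕ
    #accepted N s = #words N (accepts s)

    #accepted-words : ∀ N s → #accepted N s ≡ countᵇ (accepts s) (words N)
    #accepted-words N s = refl

  infix 8 #[_]_

  #[_]_ : ℕ → Maybe S → ℕ
  #[ N ] nothing = 0
  #[ N ] just s = #accepted N s

  opaque
    unfolding #accepted

    #-zero : ∀ s → #[ 0 ] just s ≡ 𝟙 (accepts s [])
    #-zero s = #words-zero (accepts s)

    #-none : ∀ N s → (∀ w → length w ≡ N → accepts s w ≡ false) → #[ N ] just s ≡ 0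
    #-none N s = #words-none N (accepts s)

    #-after : ∀ N s x → #words N (λ w → accepts s (x ∷ w)) ≡ #[ N ] step s x
    #-after N s x with step s x | accepts-∷ s x
    ... | nothing | e = #words-none N _ (λ w _ → e w)
    ... | just s′ | e = #words-cong N e

    #-suc : ∀ N s → #[ suc N ] just s ≡ #[ N ] step s U + (#[ N ] step s D + #[ N ] step s L)
    #-suc N s = trans (#words-suc N (accepts s)) (cong₂ _+_ (#-after N s U) (cong₂ _+_ (#-after N s D) (#-after N s L)))

  #-step : ∀ N s {a b c} → #[ N ] step s U ≡ a → #[ N ] step s D ≡ b → #[ N ] step s L ≡ c →
           #[ suc N ] just s ≡ a + (b + c)
  #-step N s eU eD eL = trans (#-suc N s) (cong₂ _+_ eU (cong₂ _+_ eD eL))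

  #-resize : ∀ {N M} s {a} → N ≡ M → #[ N ] s ≡ a → #[ M ] s ≡ a
  #-resize s refl e = e

balanced-short : ∀ h w → length w < h → balanced h w ≡ false
balanced-short (suc h) [] _ = refl
balanced-short (suc h) (U ∷ w) (s≤s lt) = balanced-short (suc (suc h)) w (m<n⇒m<1+n (m<n⇒m<1+n lt))
balanced-short (suc h) (D ∷ w) (s≤s lt) = balanced-short h w lt
balanced-short (suc h) (L ∷ w) (s≤s lt) = balanced-short h w lt

balanced-U : ∀ h w → balanced h (U ∷ w) ≡ balanced (suc h) w
balanced-U zero w = refl
balanced-U (suc h) w = refl

-- 0-box paths (k = 3)

module ZeroBox where

  two-more-up : ∀ h e → suc (suc h) + 2 * e ≡ h + 2 * suc e
  two-more-up = solve-∀

  up-then-down : ∀ h c → suc (suc (suc h) + 2 * c) ≡ suc h + 2 * suc c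
  up-then-down = solve-∀

  up-from-ground : ∀ c → suc (suc (2 * c)) ≡ 2 * suc c
  up-from-ground = solve-∀

  -- height, length of the current run of U's, long ascents still to come
  Config : Set
  Config = ℕ × ℕ × ℕ

  accepts : Config → Word → Bool
  accepts (h , r , t) w = (noL w ∧ balanced h w) ∧ (longAscentsFrom r (zeroBoxOf w) ≡ᵇ t)

  step : Config → Step → Maybe Config
  step (h , r , t) U = just (suc h , suc r , t)
  step (zero , r , t) D = nothing
  step (suc h , zero , t) D = just (h , 0 , t)
  step (suc h , suc r , zero) D = nothing
  step (suc h , suc r , suc t) D = just (h , 0 , t)
  step _ L = nothing

  accepts-∷ : ∀ s x w → accepts s (x ∷ w) ≡ maybe′ (λ s′ → accepts s′ w) false (step s x)
  accepts-∷ (zero , r , t) U w = refl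
  accepts-∷ (suc h , r , t) U w = refl
  accepts-∷ (zero , r , t) D w = ∧-false-∧ (noL w) _
  accepts-∷ (suc h , zero , t) D w = refl
  accepts-∷ (suc h , suc r , zero) D w = ∧-zeroʳ _
  accepts-∷ (suc h , suc r , suc t) D w = refl
  accepts-∷ s L w = refl

  open Automaton accepts step accepts-∷

  #-too-short : ∀ N h r t → N < h → #[ N ] just (h , r , t) ≡ 0
  #-too-short N h r t N<h = #-none N (h , r , t) too-low
    where
    too-low : ∀ w → length w ≡ N → accepts (h , r , t) w ≡ false
    too-low w refl rewrite balanced-short h w N<h = ∧-false-∧ (noL w) _

  #-run-without-peaks : ∀ N h r → #[ N ] just (h , suc r , 0) ≡ 0
  #-run-without-peaks zero h r = trans (#-zero _) (cong 𝟙 (∧-zeroʳ _))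
  #-run-without-peaks (suc N) zero r = #-step N _ (#-run-without-peaks N 1 (suc r)) refl refl
  #-run-without-peaks (suc N) (suc h) r = #-step N _ (#-run-without-peaks N (suc (suc h)) (suc r)) refl refl

  #-descent : ∀ h → #[ h ] just (h , 0 , 0) ≡ 1
  #-descent zero = #-zero _
  #-descent (suc h) = #-step h _ (#-run-without-peaks h (suc (suc h)) 0) (#-descent h) refl

  #-overshoot : ∀ N h → h < N → #[ N ] just (h , 0 , 0) ≡ 0
  #-overshoot (suc N) zero _ = #-step N _ (#-run-without-peaks N 1 0) refl refl
  #-overshoot (suc N) (suc h) (s≤s h<N) =
    #-step N _ (#-run-without-peaks N (suc (suc h)) 0) (#-overshoot N h h<N) refl

  #-one-peak-in-run : ∀ e h r → #[ suc h + 2 * e ] just (suc h , suc r , 1) ≡ 1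
  #-one-peak-in-run zero h r = #-step (h + 0) _
    (#-too-short (h + 0) (suc (suc h)) (suc (suc r)) 1 (s≤s (≤-trans (≤-reflexive (+-identityʳ h)) (n≤1+n h))))
    (#-resize (just (h , 0 , 0)) (sym (+-identityʳ h)) (#-descent h))
    refl
  #-one-peak-in-run (suc e) h r = #-step (h + 2 * suc e) _
    (#-resize (just (suc (suc h) , suc (suc r) , 1)) (two-more-up h e) (#-one-peak-in-run e (suc h) (suc r)))
    (#-overshoot (h + 2 * suc e) h
      (subst (h <_) (two-more-up h e) (≤-trans (n≤1+n (suc h)) (m≤m+n (suc (suc h)) (2 * e)))))
    refl

  #-one-peak-too-short : ∀ h → #[ h ] just (h , 0 , 1) ≡ 0
  #-one-peak-too-short zero = #-zero _
  #-one-peak-too-short (suc h) =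
    #-step h _ (#-too-short h (suc (suc h)) 1 1 (n≤1+n (suc h))) (#-one-peak-too-short h) refl

  #-one-peak : ∀ c h → #[ h + 2 * suc c ] just (h , 0 , 1) ≡ suc h
  #-one-peak c zero = #-resize (just (0 , 0 , 1)) (up-from-ground c)
    (#-step (suc (2 * c)) _ (#-one-peak-in-run c 0 0) refl refl)
  #-one-peak c (suc h) = #-resize (just (suc h , 0 , 1)) (up-then-down h c)
    (trans (#-step (suc (suc h) + 2 * c) _
             (#-one-peak-in-run c (suc h) 0)
             (#-resize (just (h , 0 , 1)) (sym (two-more-up h c)) (#-one-peak c h))
             refl)
           (cong suc (+-identityʳ (suc h))))

  #-two-peaks-in-run : ∀ c h r → #[ suc h + 2 * c ] just (suc h , suc r , 2) ≡ sumFrom id (suc h) c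
  #-two-peaks-in-run zero h r = #-resize (just (suc h , suc r , 2)) (sym (cong suc (+-identityʳ h)))
    (#-step h _ (#-too-short h (suc (suc h)) (suc (suc r)) 2 (n≤1+n (suc h))) (#-one-peak-too-short h) refl)
  #-two-peaks-in-run (suc c) h r = #-resize (just (suc h , suc r , 2)) (up-then-down h c)
    (trans (#-step (suc (suc h) + 2 * c) _
             (#-two-peaks-in-run c (suc h) (suc r))
             (#-resize (just (h , 0 , 1)) (sym (two-more-up h c)) (#-one-peak c h))
             refl)
           (trans (cong (sumFrom id (suc (suc h)) c +_) (+-identityʳ (suc h)))
                  (+-comm (sumFrom id (suc (suc h)) c) (suc h))))

  #-two-peaks : ∀ n → #[ 2 * suc n ] just (0 , 0 , 2) ≡ sumFrom id 1 n
  #-two-peaks n = #-resize (just (0 , 0 , 2)) (up-from-ground n)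
    (trans (#-step (suc (2 * n)) _ (#-two-peaks-in-run n 0 0) refl refl) (+-identityʳ _))

  two-peaks-count : ∀ n → 2 * countTwoLong 0 (suc n + 1) ≡ suc n * n
  two-peaks-count n = +-cancelʳ-≡ n _ _ (begin
    2 * countTwoLong 0 (suc n + 1) + n  ≡⟨ cong (λ m → 2 * m + n) count≡sum ⟩
    2 * sumFrom id 1 n + n             ≡⟨ sumFrom-id-closed 1 n ⟩
    n * (2 * 1 + n)                     ≡⟨ rearrange n ⟩
    suc n * n + n                       ∎)
    where
    open ≡-Reasoning
    M : ℕ
    M = 2 * ((suc n + 1) ∸ 1)
    rearrange : ∀ n → n * (2 * 1 + n) ≡ suc n * n + n
    rearrange = solve-∀
    count≡sum : countTwoLong 0 (suc n + 1) ≡ sumFrom id 1 n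
    count≡sum = begin
      countTwoLong 0 (suc n + 1)
        ≡⟨ countᵇ-map (λ w → longAscents w ≡ᵇ 2) zeroBoxOf (filterᵇ isDyck (words M)) ⟩
      countᵇ (λ w → longAscents (zeroBoxOf w) ≡ᵇ 2) (filterᵇ isDyck (words M))
        ≡⟨ countᵇ-filterᵇ (λ w → longAscents (zeroBoxOf w) ≡ᵇ 2) isDyck (words M) ⟩
      countᵇ (accepts (0 , 0 , 2)) (words M)
        ≡⟨ #accepted-words M (0 , 0 , 2) ⟨
      #[ M ] just (0 , 0 , 2)
        ≡⟨ #-resize (just (0 , 0 , 2)) (sym (cong (2 *_) (m+n∸n≡m (suc n) 1))) (#-two-peaks n) ⟩
      sumFrom id 1 n ∎

-- J-box paths (J = j + 1 ≥ 1)

module Boxes (j : ℕ) where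

  J : ℕ
  J = suc j

  -- inside d: the last U is followed by J - d letters D, so a box factor is completed
  -- exactly if D^d L comes next.
  data Progress : Set where
    outside : Progress
    inside : ℕ → Progress

  record Config : Set where
    constructor config
    field
      previous : Maybe Step
      height   : ℕ
      progress : Progress
      boxesLeft : ℕ
      run      : ℕ
      longAscentsLeft : ℕ

  noULLU-after : Maybe Step → Word → Bool
  noULLU-after nothing w = noULLU w
  noULLU-after (just x) w = noULLU (x ∷ w)

  boxesAhead : Progress → Word → ℕ
  boxesAhead outside w = occurrences (boxFactor J) w
  boxesAhead (inside d) w =
    (if isPrefix (replicate d D ++ L ∷ []) w then 1 else 0) + occurrences (boxFactor J) w

  accepts : Config → Word → Bool
  accepts (config p h b c r t) w =
    ((noULLU-after p w ∧ balanced h w) ∧ (boxesAhead b w ≡ᵇ c)) ∧ (longAscentsFrom r w ≡ᵇ t)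

  afterD : Progress → Progress
  afterD outside = outside
  afterD (inside zero) = outside
  afterD (inside (suc d)) = inside d

  closeRun : ℕ → ℕ → Maybe ℕ
  closeRun (suc (suc r)) zero = nothing
  closeRun (suc (suc r)) (suc t) = just t
  closeRun zero t = just t
  closeRun (suc zero) t = just t

  completeBox : Progress → ℕ → Maybe ℕ
  completeBox (inside zero) zero = nothing
  completeBox (inside zero) (suc c) = just c
  completeBox (inside (suc d)) c = just c
  completeBox outside c = just c

  stepU stepD stepL : Config → Maybe Config
  stepU (config (just L) h b c r t) = nothing
  stepU (config p h b c r t) = just (config (just U) (suc h) (inside J) c (suc r) t)
  stepD (config p zero b c r t) = nothing
  stepD (config p (suc h) b c r t) = Maybe.map (config (just D) h (afterD b) c 0) (closeRun r t)
  stepL (config p zero b c r t) = nothing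
  stepL (config (just U) (suc h) b c r t) = nothing
  stepL (config p (suc h) b c r t) =
    Maybe.zipWith (λ t′ c′ → config (just L) h outside c′ 0 t′) (closeRun r t) (completeBox b c)

  step : Config → Step → Maybe Config
  step s U = stepU s
  step s D = stepD s
  step s L = stepL s

  boxesAhead-U : ∀ b w → boxesAhead b (U ∷ w) ≡ boxesAhead (inside J) w
  boxesAhead-U outside w = refl
  boxesAhead-U (inside zero) w = refl
  boxesAhead-U (inside (suc d)) w = refl

  boxesAhead-D : ∀ b w → boxesAhead b (D ∷ w) ≡ boxesAhead (afterD b) w
  boxesAhead-D outside w = refl
  boxesAhead-D (inside zero) w = refl
  boxesAhead-D (inside (suc d)) w = refl

  boxesAhead-L : ∀ b c w →
    (boxesAhead b (L ∷ w) ≡ᵇ c) ≡ maybe′ (λ c′ → boxesAhead outside w ≡ᵇ c′) false (completeBox b c)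
  boxesAhead-L outside c w = refl
  boxesAhead-L (inside zero) zero w = refl
  boxesAhead-L (inside zero) (suc c) w = refl
  boxesAhead-L (inside (suc d)) c w = refl

  closeRun-spec : ∀ r t n →
    ((if 1 <ᵇ r then 1 else 0) + n ≡ᵇ t) ≡ maybe′ (λ t′ → n ≡ᵇ t′) false (closeRun r t)
  closeRun-spec zero t n = refl
  closeRun-spec (suc zero) t n = refl
  closeRun-spec (suc (suc r)) zero n = refl
  closeRun-spec (suc (suc r)) (suc t) n = refl

  noULLU-after-D : ∀ p w → noULLU-after p (D ∷ w) ≡ noULLU-after (just D) w
  noULLU-after-D nothing w = refl
  noULLU-after-D (just U) w = refl
  noULLU-after-D (just D) w = refl
  noULLU-after-D (just L) w = refl

  accepts-U : ∀ p h b c r t w → noULLU-after p (U ∷ w) ≡ noULLU-after (just U) w →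
    accepts (config p h b c r t) (U ∷ w) ≡ accepts (config (just U) (suc h) (inside J) c (suc r) t) w
  accepts-U p h b c r t w allowed rewrite allowed | balanced-U h w | boxesAhead-U b w = refl

  accepts-D : ∀ p h b c r t w → accepts (config p (suc h) b c r t) (D ∷ w) ≡
    maybe′ (λ s′ → accepts s′ w) false (Maybe.map (config (just D) h (afterD b) c 0) (closeRun r t))
  accepts-D p h b c r t w rewrite noULLU-after-D p w | boxesAhead-D b w = begin
    a ∧ (longAscentsFrom r (D ∷ w) ≡ᵇ t)
      ≡⟨ cong (a ∧_) (closeRun-spec r t (longAscentsFrom 0 w)) ⟩
    a ∧ maybe′ (λ t′ → longAscentsFrom 0 w ≡ᵇ t′) false m
      ≡⟨ ∧-maybe′ a _ m ⟩
    maybe′ (λ t′ → accepts (config (just D) h (afterD b) c 0 t′) w) false m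
      ≡⟨ maybe′-map (λ s′ → accepts s′ w) false (config (just D) h (afterD b) c 0) m ⟨
    _                                                     ∎
    where
    open ≡-Reasoning
    a : Bool
    a = (noULLU (D ∷ w) ∧ balanced h w) ∧ (boxesAhead (afterD b) w ≡ᵇ c)
    m : Maybe ℕ
    m = closeRun r t

  accepts-L : ∀ p h b c r t w → noULLU-after p (L ∷ w) ≡ noULLU-after (just L) w →
    accepts (config p (suc h) b c r t) (L ∷ w) ≡ maybe′ (λ s′ → accepts s′ w) false
      (Maybe.zipWith (λ t′ c′ → config (just L) h outside c′ 0 t′) (closeRun r t) (completeBox b c))
  accepts-L p h b c r t w allowed
    rewrite allowed | boxesAhead-L b c w | closeRun-spec r t (longAscentsFrom 0 w)
    = both (closeRun r t) (completeBox b c)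
    where
    both : ∀ mt mc →
      ((noULLU (L ∷ w) ∧ balanced h w) ∧ maybe′ (λ c′ → boxesAhead outside w ≡ᵇ c′) false mc)
        ∧ maybe′ (λ t′ → longAscentsFrom 0 w ≡ᵇ t′) false mt
      ≡ maybe′ (λ s′ → accepts s′ w) false
          (Maybe.zipWith (λ t′ c′ → config (just L) h outside c′ 0 t′) mt mc)
    both nothing mc = ∧-zeroʳ _
    both (just t′) nothing = cong (_∧ (longAscentsFrom 0 w ≡ᵇ t′)) (∧-zeroʳ (noULLU (L ∷ w) ∧ balanced h w))
    both (just t′) (just c′) = refl

  accepts-∷ : ∀ s x w → accepts s (x ∷ w) ≡ maybe′ (λ s′ → accepts s′ w) false (step s x)
  accepts-∷ (config (just L) h b c r t) U w = refl
  accepts-∷ (config nothing h b c r t) U w = accepts-U nothing h b c r t w refl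
  accepts-∷ (config (just U) h b c r t) U w = accepts-U (just U) h b c r t w refl
  accepts-∷ (config (just D) h b c r t) U w = accepts-U (just D) h b c r t w refl
  accepts-∷ (config p zero b c r t) D w = cong (_∧ _) (∧-false-∧ (noULLU-after p (D ∷ w)) _)
  accepts-∷ (config p (suc h) b c r t) D w = accepts-D p h b c r t w
  accepts-∷ (config p zero b c r t) L w = cong (_∧ _) (∧-false-∧ (noULLU-after p (L ∷ w)) _)
  accepts-∷ (config (just U) (suc h) b c r t) L w = refl
  accepts-∷ (config nothing (suc h) b c r t) L w = accepts-L nothing h b c r t w refl
  accepts-∷ (config (just D) (suc h) b c r t) L w = accepts-L (just D) h b c r t w refl
  accepts-∷ (config (just L) (suc h) b c r t) L w = accepts-L (just L) h b c r t w refl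

  open Automaton accepts step accepts-∷

  boxesAhead-[] : ∀ b → boxesAhead b [] ≡ 0
  boxesAhead-[] outside = refl
  boxesAhead-[] (inside zero) = refl
  boxesAhead-[] (inside (suc d)) = refl

  accepts-[]-boxes-left : ∀ p h b c r t → accepts (config p h b (suc c) r t) [] ≡ false
  accepts-[]-boxes-left p h b c r t rewrite boxesAhead-[] b =
    ∧-false-∧ (noULLU-after p [] ∧ balanced h []) (longAscentsFrom r [] ≡ᵇ t)

  -- need p b c bounds the number of down-steps (D or L) of a completion from a configuration
  -- with c + 1 box factors still to be found: the next factor still needs credit b letters D
  -- and its L, each later one J letters D, its L and a D after the previous L (LU is forbidden),
  -- and one more such D is due if the last letter was L. A completion ends at the ground, so its
  -- length plus the current height is twice its number of down-steps.
  credit : Progress → ℕ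
  credit outside = J
  credit (inside d) = d

  isL : Maybe Step → ℕ
  isL (just L) = 1
  isL _ = 0

  need : Maybe Step → Progress → ℕ → ℕ
  need p b c = c * (J + 2) + credit b + 1 + isL p

  WellFormed : Maybe Step → Progress → Set
  WellFormed p outside = ⊤
  WellFormed (just L) (inside d) = ⊥
  WellFormed p (inside d) = d ≤ J

  wellFormed-inside-notL : ∀ p d → WellFormed p (inside d) → isL p ≡ 0
  wellFormed-inside-notL nothing d _ = refl
  wellFormed-inside-notL (just U) d _ = refl
  wellFormed-inside-notL (just D) d _ = refl

  credit≤J : ∀ p b → WellFormed p b → credit b ≤ J
  credit≤J p outside _ = ≤-refl
  credit≤J nothing (inside d) d≤J = d≤J
  credit≤J (just U) (inside d) d≤J = d≤J
  credit≤J (just D) (inside d) d≤J = d≤J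

  isL≤1 : ∀ p → isL p ≤ 1
  isL≤1 nothing = z≤n
  isL≤1 (just U) = z≤n
  isL≤1 (just D) = z≤n
  isL≤1 (just L) = ≤-refl

  need-mono : ∀ c {a a′ x x′} → a ≤ a′ → x ≤ x′ → c * (J + 2) + a + 1 + x ≤ c * (J + 2) + a′ + 1 + x′
  need-mono c a≤a′ x≤x′ = +-mono-≤ (+-monoˡ-≤ 1 (+-monoʳ-≤ (c * (J + 2)) a≤a′)) x≤x′

  need-U : ∀ p b c → WellFormed p b → isL p ≡ 0 → need p b c ≤ need (just U) (inside J) c
  need-U p b c wf notL rewrite notL = need-mono c (credit≤J p b wf) z≤n

  need-D : ∀ p b c → WellFormed p b → need p b c ≤ suc (need (just D) (afterD b) c)
  need-D p outside c _ = ≤-trans (need-mono c ≤-refl (isL≤1 p)) (≤-reflexive (+-suc _ 0))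
  need-D p (inside zero) c wf rewrite wellFormed-inside-notL p zero wf = ≤-trans (need-mono c z≤n z≤n) (n≤1+n _)
  need-D p (inside (suc d)) c wf rewrite wellFormed-inside-notL p (suc d) wf =
    ≤-reflexive (cong (λ n → n + 1 + 0) (+-suc (c * (J + 2)) d))

  need-L : ∀ p b c → WellFormed p b → need p b c ≤ need (just L) outside c
  need-L p b c wf = need-mono c (credit≤J p b wf) (isL≤1 p)

  need-box : ∀ p c → isL p ≡ 0 → need p (inside zero) (suc c) ≡ suc (need (just L) outside c)
  need-box p c notL rewrite notL = regroup j c
    where
    regroup : ∀ j c → suc c * (suc j + 2) + 0 + 1 + 0 ≡ suc (c * (suc j + 2) + suc j + 1 + 1)
    regroup = solve-∀

  wellFormed-D : ∀ p b → WellFormed p b → WellFormed (just D) (afterD b)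
  wellFormed-D p outside _ = tt
  wellFormed-D p (inside zero) _ = tt
  wellFormed-D nothing (inside (suc d)) sd≤J = ≤-trans (n≤1+n d) sd≤J
  wellFormed-D (just U) (inside (suc d)) sd≤J = ≤-trans (n≤1+n d) sd≤J
  wellFormed-D (just D) (inside (suc d)) sd≤J = ≤-trans (n≤1+n d) sd≤J

  accepts-next : ∀ s x w → accepts s (x ∷ w) ≡ true → maybe′ (λ s′ → accepts s′ w) false (step s x) ≡ true
  accepts-next s x w = trans (sym (accepts-∷ s x w))

  budget-up : ∀ {a a′ n h} → a ≤ a′ → 2 * a′ ≤ n + suc h → 2 * a ≤ suc n + h
  budget-up {n = n} {h} a≤a′ le = ≤-trans (*-monoʳ-≤ 2 a≤a′) (≤-trans le (≤-reflexive (+-suc n h)))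

  budget-down : ∀ {a a′ n h} → a ≤ suc a′ → 2 * a′ ≤ n + h → 2 * a ≤ suc n + suc h
  budget-down {a} {a′} {n} {h} a≤ le = begin
    2 * a          ≤⟨ *-monoʳ-≤ 2 a≤ ⟩
    2 * suc a′     ≡⟨ *-suc 2 a′ ⟩
    2 + 2 * a′     ≤⟨ +-monoʳ-≤ 2 le ⟩
    2 + (n + h)    ≡⟨ +-suc-suc n h ⟩
    suc n + suc h  ∎
    where
    open ≤-Reasoning

  budget : ∀ w p h b c r t → WellFormed p b → accepts (config p h b (suc c) r t) w ≡ true →
           2 * need p b c ≤ length w + h
  budget-L : ∀ w p h b c r t → WellFormed p b →
    maybe′ (λ s′ → accepts s′ w) false
      (Maybe.zipWith (λ t′ c′ → config (just L) h outside c′ 0 t′) (closeRun r t) (completeBox b (suc c)))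
    ≡ true →
    2 * need p b c ≤ suc (length w) + suc h

  budget [] p h b c r t wf acc = ⊥-elim (false≢true (trans (sym (accepts-[]-boxes-left p h b c r t)) acc))
  budget (U ∷ w) (just L) h b c r t wf ()
  budget (U ∷ w) nothing h b c r t wf acc = budget-up (need-U nothing b c wf refl)
    (budget w (just U) (suc h) (inside J) c (suc r) t ≤-refl (accepts-next (config nothing h b (suc c) r t) U w acc))
  budget (U ∷ w) (just U) h b c r t wf acc = budget-up (need-U (just U) b c wf refl)
    (budget w (just U) (suc h) (inside J) c (suc r) t ≤-refl (accepts-next (config (just U) h b (suc c) r t) U w acc))
  budget (U ∷ w) (just D) h b c r t wf acc = budget-up (need-U (just D) b c wf refl)
    (budget w (just U) (suc h) (inside J) c (suc r) t ≤-refl (accepts-next (config (just D) h b (suc c) r t) U w acc))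
  budget (D ∷ w) p zero b c r t wf acc = ⊥-elim (false≢true (accepts-next (config p zero b (suc c) r t) D w acc))
  budget (D ∷ w) p (suc h) b c r t wf acc =
    descend (closeRun r t) (accepts-next (config p (suc h) b (suc c) r t) D w acc)
    where
    descend : ∀ m →
      maybe′ (λ s′ → accepts s′ w) false (Maybe.map (config (just D) h (afterD b) (suc c) 0) m) ≡ true →
              2 * need p b c ≤ suc (length w) + suc h
    descend (just t′) acc′ =
      budget-down (need-D p b c wf) (budget w (just D) h (afterD b) c 0 t′ (wellFormed-D p b wf) acc′)
  budget (L ∷ w) p zero b c r t wf acc = ⊥-elim (false≢true (accepts-next (config p zero b (suc c) r t) L w acc))
  budget (L ∷ w) (just U) (suc h) b c r t wf ()
  budget (L ∷ w) nothing (suc h) b c r t wf acc =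
    budget-L w nothing h b c r t wf (accepts-next (config nothing (suc h) b (suc c) r t) L w acc)
  budget (L ∷ w) (just D) (suc h) b c r t wf acc =
    budget-L w (just D) h b c r t wf (accepts-next (config (just D) (suc h) b (suc c) r t) L w acc)
  budget (L ∷ w) (just L) (suc h) b c r t wf acc =
    budget-L w (just L) h b c r t wf (accepts-next (config (just L) (suc h) b (suc c) r t) L w acc)

  budget-L w p h b c r t wf acc with closeRun r t
  budget-L w p h outside c r t wf acc | just t′ =
    budget-down (≤-trans (need-L p outside c wf) (n≤1+n _)) (budget w (just L) h outside c 0 t′ tt acc)
  budget-L w p h (inside (suc d)) c r t wf acc | just t′ =
    budget-down (≤-trans (need-L p (inside (suc d)) c wf) (n≤1+n _)) (budget w (just L) h outside c 0 t′ tt acc)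
  budget-L w p h (inside zero) zero r t wf acc | just t′
    rewrite wellFormed-inside-notL p zero wf = s≤s (≤-trans (s≤s z≤n) (m≤n+m (suc h) (length w)))
  budget-L w p h (inside zero) (suc c) r t wf acc | just t′ =
    budget-down (≤-reflexive (need-box p c (wellFormed-inside-notL p zero wf))) (budget w (just L) h outside c 0 t′ tt acc)

  #-over-budget : ∀ N p h b c r t → WellFormed p b → N + h < 2 * need p b c →
                  #[ N ] just (config p h b (suc c) r t) ≡ 0
  #-over-budget N p h b c r t wf N+h<2need = #-none N _ rejected
    where
    rejected : ∀ w → length w ≡ N → accepts (config p h b (suc c) r t) w ≡ false
    rejected w refl with accepts (config p h b (suc c) r t) w in acc
    ... | false = refl
    ... | true = ⊥-elim (<⇒≱ N+h<2need (budget w p h b c r t wf acc))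

  #-too-short : ∀ N p h b c r t → N < h → #[ N ] just (config p h b c r t) ≡ 0
  #-too-short N p h b c r t N<h = #-none N _ too-low
    where
    too-low : ∀ w → length w ≡ N → accepts (config p h b c r t) w ≡ false
    too-low w refl rewrite balanced-short h w N<h = cong (_∧ _) (∧-false-∧ (noULLU-after p w) _)

  #-long-run-exhausted : ∀ N p h b c r → #[ N ] just (config p h b c (suc (suc r)) 0) ≡ 0
  #-long-run-exhausted N p h b c r = #-none N _ λ w _ →
    trans (cong (((noULLU-after p w ∧ balanced h w) ∧ (boxesAhead b w ≡ᵇ c)) ∧_) (long-run-counted r w))
          (∧-zeroʳ _)
    where
    long-run-counted : ∀ r w → (longAscentsFrom (suc (suc r)) w ≡ᵇ 0) ≡ false
    long-run-counted r [] = refl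
    long-run-counted r (U ∷ w) = long-run-counted (suc r) w
    long-run-counted r (D ∷ w) = refl
    long-run-counted r (L ∷ w) = refl

  <-double : ∀ {x a b} → x ≡ 2 * a → a < b → x < 2 * b
  <-double {a = a} {b} refl a<b =
    ≤-trans (s≤s (n≤1+n (2 * a))) (≤-trans (≤-reflexive (sym (*-suc 2 a))) (*-monoʳ-≤ 2 a<b))

  <-double-2+ : ∀ {x a b} → 2 + x ≡ 2 * a → a ≤ b → x < 2 * b
  <-double-2+ {x} {a} {b} e a≤b = ≤-trans (m≤n+m (suc x) 1) (≤-trans (≤-reflexive e) (*-monoʳ-≤ 2 a≤b))

  need-inside-< : ∀ c {d} → d < J → need (just D) (inside d) c < need (just U) (inside J) c
  need-inside-< c d<J = +-monoˡ-< 0 (+-monoˡ-< 1 (+-monoʳ-< (c * (J + 2)) d<J))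

  need-inside-suc : ∀ c d → 2 * need (just D) (inside (suc d)) c ≡ 2 + 2 * need (just D) (inside d) c
  need-inside-suc c d = expand (c * (J + 2)) d
    where
    expand : ∀ a d → 2 * (a + suc d + 1 + 0) ≡ 2 + 2 * (a + d + 1 + 0)
    expand = solve-∀

  #-finish-box : ∀ d N h c t → d ≤ j → (d + suc N) + (d + suc h) ≡ 2 * need (just D) (inside d) c →
    #[ d + suc N ] just (config (just D) (d + suc h) (inside d) (suc c) 0 t) ≡ #[ N ] just (config (just L) h outside c 0 t)
  #-finish-box zero N h c t _ tight = #-step N _
    (#-over-budget N (just U) (suc (suc h)) (inside J) c 1 t ≤-refl
      (<-double (trans (+-suc N (suc h)) tight) (need-inside-< c (s≤s z≤n))))
    (#-over-budget N (just D) h outside c 0 t tt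
      (<-double-2+ (trans (+-suc-suc N h) tight) (need-mono c z≤n ≤-refl)))
    refl
  #-finish-box (suc d) N h c t sd≤j tight = trans (#-step (d + suc N) _
    (#-over-budget (d + suc N) (just U) (suc (suc (d + suc h))) (inside J) c 1 t ≤-refl
      (<-double (trans (shift-U d N h) tight) (need-inside-< c (s≤s sd≤j))))
    (#-finish-box d N h c t (≤-trans (n≤1+n d) sd≤j)
      (+-cancelˡ-≡ 2 _ _ (trans (shift-D d N h) (trans tight (need-inside-suc c d)))))
    (#-over-budget (d + suc N) (just L) (d + suc h) outside c 0 t tt
      (<-double-2+ (trans (shift-D d N h) tight) (need-L (just D) (inside (suc d)) c (≤-trans sd≤j (n≤1+n j))))))
    (+-identityʳ _)
    where
    shift-U : ∀ d N h → (d + suc N) + suc (suc (d + suc h)) ≡ (suc d + suc N) + (suc d + suc h)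
    shift-U = solve-∀
    shift-D : ∀ d N h → 2 + ((d + suc N) + (d + suc h)) ≡ (suc d + suc N) + (suc d + suc h)
    shift-D = solve-∀

  #-box-too-low : ∀ d N h c t → d ≤ j → h ≤ d → N + h ≡ 2 * need (just D) (inside d) c →
    #[ N ] just (config (just D) h (inside d) (suc c) 0 t) ≡ 0
  #-box-too-low d zero h c t _ _ _ = trans (#-zero _) (cong 𝟙 (accepts-[]-boxes-left (just D) h (inside d) c 0 t))
  #-box-too-low d (suc N) zero c t d≤j _ tight = #-step N _
    (#-over-budget N (just U) 1 (inside J) c 1 t ≤-refl (<-double (trans (+-suc N 0) tight) (need-inside-< c (s≤s d≤j))))
    refl refl
  #-box-too-low (suc d) (suc N) (suc h) c t sd≤j (s≤s h≤d) tight = #-step N _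
    (#-over-budget N (just U) (suc (suc h)) (inside J) c 1 t ≤-refl
      (<-double (trans (+-suc N (suc h)) tight) (need-inside-< c (s≤s sd≤j))))
    (#-box-too-low d N h c t (≤-trans (n≤1+n d) sd≤j) h≤d
      (+-cancelˡ-≡ 2 _ _ (trans (+-suc-suc N h) (trans tight (need-inside-suc c d)))))
    (#-over-budget N (just L) h outside c 0 t tt
      (<-double-2+ (trans (+-suc-suc N h) tight) (need-L (just D) (inside (suc d)) c (≤-trans sd≤j (n≤1+n j)))))

  #-grounded : ∀ N c t → #[ N ] just (config (just L) 0 outside (suc c) 0 t) ≡ 0
  #-grounded zero c t = trans (#-zero _) (cong 𝟙 (accepts-[]-boxes-left (just L) 0 outside c 0 t))
  #-grounded (suc N) c t = #-step N _ refl refl refl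

  #-one-letter-left : ∀ h c t → #[ 1 ] just (config (just L) h outside (suc c) 0 t) ≡ 0
  #-one-letter-left zero c t = #-grounded 1 c t
  #-one-letter-left (suc h) c t = #-step 0 _ refl
    (trans (#-zero _) (cong 𝟙 (accepts-[]-boxes-left (just D) h outside c 0 t)))
    (trans (#-zero _) (cong 𝟙 (accepts-[]-boxes-left (just L) h outside c 0 t)))

  need-after-L : ∀ c → 2 * need (just L) outside c ≡ 2 + 2 * need (just D) outside c
  need-after-L c = expand (c * (J + 2)) j
    where
    expand : ∀ a j → 2 * (a + suc j + 1 + 1) ≡ 2 + 2 * (a + suc j + 1 + 0)
    expand = solve-∀

  #-up-after-box : ∀ N h c t → suc N + h ≡ 2 * need (just D) outside c →
    #[ suc N ] just (config (just D) h outside (suc c) 0 t) ≡ #[ N ] just (config (just U) (suc h) (inside J) (suc c) 1 t)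
  #-up-after-box N zero c t _ = trans (#-step N _ refl refl refl) (+-identityʳ _)
  #-up-after-box N (suc h) c t tight = trans (#-step N _ refl
    (#-over-budget N (just D) h outside c 0 t tt
      (<-double-2+ {a = need (just D) outside c} (trans (+-suc-suc N h) tight) ≤-refl))
    (#-over-budget N (just L) h outside c 0 t tt (<-double-2+ (trans (+-suc-suc N h) tight) (need-L (just D) outside c tt))))
    (+-identityʳ _)

  #-between-boxes : ∀ N h c t → suc (suc N) + suc h ≡ 2 * need (just L) outside c →
    #[ suc (suc N) ] just (config (just L) (suc h) outside (suc c) 0 t) ≡
    #[ N ] just (config (just U) (suc h) (inside J) (suc c) 1 t)
  #-between-boxes N h c t tight = trans (#-step (suc N) _ refl
    (#-up-after-box N h c t (+-cancelˡ-≡ 2 _ _ (trans (+-suc-suc (suc N) h) (trans tight (need-after-L c)))))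
    (#-over-budget (suc N) (just L) h outside c 0 t tt
      (<-double-2+ {a = need (just L) outside c} (trans (+-suc-suc (suc N) h) tight) ≤-refl)))
    (+-identityʳ _)

  last-box-need : 2 * need (just D) (inside j) 0 ≡ J + J
  last-box-need = expand j
    where
    expand : ∀ j → 2 * (j + 1 + 0) ≡ suc j + suc j
    expand = solve-∀

  -- J-box paths have the least possible length, so from now on the remaining length N is
  -- always tight: N + height ≡ 2 * need.
  ascent : ℕ → ℕ → ℕ → ℕ → Config
  ascent h c r t = config (just U) h (inside J) (suc c) r t

  inBox : ℕ → ℕ → ℕ → Config
  inBox h c t = config (just D) h (inside j) (suc c) 0 t

  #-finish-box-from-top : ∀ N h c t → (J + N) + (J + h) ≡ 2 * need (just D) (inside j) c →
    #[ J + N ] just (inBox (J + h) c t) ≡ #[ N ] just (config (just L) h outside c 0 t)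
  #-finish-box-from-top N h c t tight =
    subst₂ (λ n k → #[ n ] just (inBox k c t) ≡ #[ N ] just (config (just L) h outside c 0 t)) (+-suc j N) (+-suc j h)
      (#-finish-box j N h c t ≤-refl
        (subst₂ (λ n k → n + k ≡ 2 * need (just D) (inside j) c) (sym (+-suc j N)) (sym (+-suc j h)) tight))

  #-last-box : ∀ N H t → N + H ≡ 2 * need (just D) (inside j) 0 →
    #[ N ] just (inBox H 0 t) ≡ 𝟙 ((H ≡ᵇ J) ∧ (0 ≡ᵇ t))
  #-last-box N H t tight with <-cmp H J
  ... | tri< H<J _ _ rewrite ≢⇒≡ᵇ-false H J (<⇒≢ H<J) = #-box-too-low j N H 0 t ≤-refl (≤-pred H<J) tight
  ... | tri> _ _ J<H rewrite ≢⇒≡ᵇ-false H J (>⇒≢ J<H) =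
    #-too-short N (just D) H (inside j) 1 0 t (<-trans N<J J<H)
    where
    N<J : N < J
    N<J = +-cancelʳ-< J N J (<-≤-trans (+-monoʳ-< N J<H) (≤-reflexive (trans tight last-box-need)))
  ... | tri≈ _ refl _ rewrite ≡ᵇ-refl J | +-cancelʳ-≡ J N J (trans tight last-box-need) =
    subst (λ n → #[ n ] just (inBox n 0 t) ≡ 𝟙 (0 ≡ᵇ t)) (+-identityʳ J)
      (trans (#-finish-box-from-top 0 0 0 t (trans (cong₂ _+_ (+-identityʳ J) (+-identityʳ J)) (sym last-box-need)))
             (#-zero _))

  #-box-level : ∀ N c t → N + J ≡ 2 * need (just D) (inside j) (suc c) → #[ N ] just (inBox J (suc c) t) ≡ 0
  #-box-level N c t tight with ≤-<-connex J N
  ... | inj₂ N<J = #-too-short N (just D) J (inside j) (suc (suc c)) 0 t N<J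
  ... | inj₁ J≤N = subst₂ (λ n h → #[ n ] just (inBox h (suc c) t) ≡ 0) (m+[n∸m]≡n J≤N) (+-identityʳ J)
    (trans (#-finish-box-from-top (N ∸ J) 0 (suc c) t
              (trans (cong₂ _+_ (m+[n∸m]≡n J≤N) (+-identityʳ J)) tight))
           (#-grounded (N ∸ J) c t))

  #-box-low : ∀ N H c t → H ≤ J → N + H ≡ 2 * need (just D) (inside j) (suc c) →
    #[ N ] just (inBox H (suc c) t) ≡ 0
  #-box-low N H c t H≤J tight with m≤n⇒m<n∨m≡n H≤J
  ... | inj₁ H<J = #-box-too-low j N H (suc c) t ≤-refl (≤-pred H<J) tight
  ... | inj₂ refl = #-box-level N c t tight

  #-box-short : ∀ N h c t → N ≤ J + 1 → N + (J + suc h) ≡ 2 * need (just D) (inside j) (suc c) →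
    #[ N ] just (inBox (J + suc h) (suc c) t) ≡ 0
  #-box-short N h c t N≤J+1 tight with m≤n⇒m<n∨m≡n N≤J+1
  ... | inj₁ N<J+1 = #-too-short N (just D) (J + suc h) (inside j) (suc (suc c)) 0 t
                       (<-≤-trans N<J+1 (+-monoʳ-≤ J (s≤s z≤n)))
  ... | inj₂ refl = trans (#-finish-box-from-top 1 (suc h) (suc c) t tight) (#-one-letter-left (suc h) c t)

  #-box-then-ascent : ∀ M h c t → (J + (2 + M)) + (J + suc h) ≡ 2 * need (just D) (inside j) (suc c) →
    #[ J + (2 + M) ] just (inBox (J + suc h) (suc c) t) ≡ #[ M ] just (ascent (suc h) c 1 t)
  #-box-then-ascent M h c t tight = trans (#-finish-box-from-top (2 + M) (suc h) (suc c) t tight)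
    (#-between-boxes M h c t (+-cancelʳ-≡ (2 * J) _ _ (trans (lengths j M h) (trans tight (needs j c)))))
    where
    lengths : ∀ j M h → suc (suc M) + suc h + 2 * suc j ≡ (suc j + (2 + M)) + (suc j + suc h)
    lengths = solve-∀
    needs : ∀ j c → 2 * (suc c * (suc j + 2) + j + 1 + 0) ≡ 2 * (c * (suc j + 2) + suc j + 1 + 1) + 2 * suc j
    needs = solve-∀

  -- A box whose first D ends at height H either cannot be completed, or is completed with too
  -- few letters left for another ascent, or is followed by D U and M more letters.
  data BoxCase (N : ℕ) : ℕ → Set where
    low   : ∀ {H} → H ≤ J → BoxCase N H
    short : ∀ h → N ≤ J + 1 → BoxCase N (J + suc h)
    fits  : ∀ h M → N ≡ J + (2 + M) → BoxCase N (J + suc h)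

  boxCase : ∀ N H → BoxCase N H
  boxCase N H with ≤-<-connex H J
  ... | inj₁ H≤J = low H≤J
  ... | inj₂ J<H = subst (BoxCase N) above-top (by-length (N ≤? J + 1))
    where
    h : ℕ
    h = H ∸ suc J
    above-top : J + suc h ≡ H
    above-top = trans (+-suc J h) (m+[n∸m]≡n J<H)
    by-length : Dec (N ≤ J + 1) → BoxCase N (J + suc h)
    by-length (yes N≤J+1) = short h N≤J+1
    by-length (no N≰J+1) =
      fits h (N ∸ suc (J + 1)) (sym (trans (regroup J (N ∸ suc (J + 1))) (m+[n∸m]≡n (≰⇒> N≰J+1))))
      where
      regroup : ∀ J M → J + (2 + M) ≡ suc (J + 1) + M
      regroup = solve-∀

  -- The height after the first U of a short ascent from which c + 1 boxes, separated by D U, lead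
  -- exactly to the ground.
  descentHeight : ℕ → ℕ
  descentHeight c = suc c * (J + 1)

  ascent-to-box : ∀ N h c → suc N + suc h ≡ 2 * need (just U) (inside J) c → N + h ≡ 2 * need (just D) (inside j) c
  ascent-to-box N h c tight = +-cancelˡ-≡ 2 _ _ (trans (+-suc-suc N h) (trans tight (expand (c * (J + 2)) j)))
    where
    expand : ∀ a j → 2 * (a + suc j + 1 + 0) ≡ 2 + 2 * (a + j + 1 + 0)
    expand = solve-∀

  box-to-ascent : ∀ M h c → (J + (2 + M)) + (J + suc h) ≡ 2 * need (just D) (inside j) (suc c) →
    M + suc h ≡ 2 * need (just U) (inside J) c
  box-to-ascent M h c tight = +-cancelʳ-≡ (2 * J + 2) _ _ (trans (lengths j M h) (trans tight (needs j c)))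
    where
    lengths : ∀ j M h → M + suc h + (2 * suc j + 2) ≡ (suc j + (2 + M)) + (suc j + suc h)
    lengths = solve-∀
    needs : ∀ j c → 2 * (suc c * (suc j + 2) + j + 1 + 0) ≡ 2 * (c * (suc j + 2) + suc j + 1 + 0) + (2 * suc j + 2)
    needs = solve-∀

  descentHeight<need : ∀ c → descentHeight c < 2 * need (just U) (inside J) c
  descentHeight<need c = ≤-trans (m≤m+n (suc (descentHeight c)) (c * j + 4 * c + j + 1)) (≤-reflexive (expand j c))
    where
    expand : ∀ j c → suc (suc c * (suc j + 1)) + (c * j + 4 * c + j + 1) ≡ 2 * (c * (suc j + 2) + suc j + 1 + 0)
    expand = solve-∀

  low<descentHeight : ∀ {H} c → H ≤ J → suc H < descentHeight (suc c)
  low<descentHeight {H} c H≤J = ≤-trans (s≤s (≤-trans (s≤s H≤J) (≤-reflexive (+-comm 1 J))))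
    (≤-trans (m≤m+n (suc (J + 1)) (c * (J + 1) + J)) (≤-reflexive (expand j c)))
    where
    expand : ∀ j c → suc (suc j + 1) + (c * (suc j + 1) + suc j) ≡ suc (suc c) * (suc j + 1)
    expand = solve-∀

  short-above-descent : ∀ N h c → N ≤ J + 1 → N + (J + suc h) ≡ 2 * need (just D) (inside j) (suc c) →
    descentHeight c ≤ h
  short-above-descent N h c N≤J+1 tight = ≤-pred (+-cancelˡ-≤ (J + 1 + J) _ _ (begin
    J + 1 + J + suc (descentHeight c)                  ≤⟨ m≤m+n _ (c * j + 4 * c + j + 2) ⟩
    J + 1 + J + suc (descentHeight c) + (c * j + 4 * c + j + 2) ≡⟨ expand j c ⟩
    2 * need (just D) (inside j) (suc c)               ≡⟨ tight ⟨
    N + (J + suc h)                                    ≤⟨ +-monoˡ-≤ (J + suc h) N≤J+1 ⟩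
    J + 1 + (J + suc h)                                ≡⟨ +-assoc (J + 1) J (suc h) ⟨
    J + 1 + J + suc h                                  ∎))
    where
    open ≤-Reasoning
    expand : ∀ j c → suc j + 1 + suc j + suc (suc c * (suc j + 1)) + (c * j + 4 * c + j + 2)
                     ≡ 2 * (suc c * (suc j + 2) + j + 1 + 0)
    expand = solve-∀

  #-short-ascents : ∀ c N h → N + h ≡ 2 * need (just U) (inside J) c →
    #[ N ] just (ascent h c 1 0) ≡ 𝟙 (h ≡ᵇ descentHeight c)
  #-box-then-short-ascents : ∀ c N h → N + h ≡ 2 * need (just D) (inside j) c →
    #[ N ] just (inBox h c 0) ≡ 𝟙 (suc h ≡ᵇ descentHeight c)

  #-short-ascents c zero h tight
    rewrite ≢⇒≡ᵇ-false h (descentHeight c) (>⇒≢ (subst (descentHeight c <_) (sym tight) (descentHeight<need c)))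
    = trans (#-zero _) (cong 𝟙 (accepts-[]-boxes-left (just U) h (inside J) c 1 0))
  #-short-ascents c (suc N) zero tight = #-step N _ (#-long-run-exhausted N (just U) 1 (inside J) (suc c) 0) refl refl
  #-short-ascents c (suc N) (suc h) tight = trans (#-step N _
    (#-long-run-exhausted N (just U) (suc (suc h)) (inside J) (suc c) 0)
    (#-box-then-short-ascents c N h (ascent-to-box N h c tight))
    refl) (+-identityʳ _)

  #-box-then-short-ascents zero N h tight =
    trans (#-last-box N h 0 tight) (cong 𝟙 (trans (∧-identityʳ _) (cong (h ≡ᵇ_) (solve-J+0 j))))
    where
    solve-J+0 : ∀ j → suc j ≡ j + 1 + 0
    solve-J+0 = solve-∀
  #-box-then-short-ascents (suc c) N H tight with boxCase N H
  ... | low H≤J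
    rewrite ≢⇒≡ᵇ-false (suc H) (descentHeight (suc c)) (<⇒≢ (low<descentHeight c H≤J))
    = #-box-low N H c 0 H≤J tight
  ... | short h N≤J+1
    rewrite ≢⇒≡ᵇ-false (suc (J + suc h)) (descentHeight (suc c))
              (>⇒≢ (s≤s (≤-trans (+-monoʳ-≤ (J + 1) (short-above-descent N h c N≤J+1 tight))
                                 (≤-reflexive (+-assoc J 1 h)))))
    = #-box-short N h c 0 N≤J+1 tight
  ... | fits h M refl = begin
    #[ J + (2 + M) ] just (inBox (J + suc h) (suc c) 0) ≡⟨ #-box-then-ascent M h c 0 tight ⟩
    #[ M ] just (ascent (suc h) c 1 0)                   ≡⟨ #-short-ascents c M (suc h) (box-to-ascent M h c tight) ⟩
    𝟙 (suc h ≡ᵇ descentHeight c)                          ≡⟨ cong 𝟙 (≡ᵇ-+ˡ (J + 1) (suc h) (descentHeight c)) ⟨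
    𝟙 (J + 1 + suc h ≡ᵇ descentHeight (suc c))           ≡⟨ cong (λ n → 𝟙 (n ≡ᵇ descentHeight (suc c))) (regroup j h) ⟩
    𝟙 (suc (J + suc h) ≡ᵇ descentHeight (suc c))         ∎
    where
    open ≡-Reasoning
    regroup : ∀ j h → suc j + 1 + suc h ≡ suc (suc j + suc h)
    regroup = solve-∀

  #-last-long-ascent : ∀ c N h r → N + h ≡ 2 * need (just U) (inside J) c →
    #[ N ] just (ascent h c (suc (suc r)) 1) ≡ 𝟙 (h ≤ᵇ descentHeight c)
  #-last-long-ascent c zero h r tight
    rewrite >⇒≤ᵇ-false (subst (descentHeight c <_) (sym tight) (descentHeight<need c))
    = trans (#-zero _) (cong 𝟙 (accepts-[]-boxes-left (just U) h (inside J) c (suc (suc r)) 1))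
  #-last-long-ascent c (suc N) zero r tight =
    trans (#-step N _ (#-last-long-ascent c N 1 (suc r) (trans (+-suc N 0) tight)) refl refl) (+-identityʳ _)
  #-last-long-ascent c (suc N) (suc h) r tight = begin
    #[ suc N ] just (ascent (suc h) c (suc (suc r)) 1)
      ≡⟨ #-step N _ (#-last-long-ascent c N (suc (suc h)) (suc r) (trans (+-suc N (suc h)) tight))
                    (#-box-then-short-ascents c N h (ascent-to-box N h c tight)) refl ⟩
    𝟙 (suc (suc h) ≤ᵇ descentHeight c) + (𝟙 (suc h ≡ᵇ descentHeight c) + 0)
      ≡⟨ cong (𝟙 (suc (suc h) ≤ᵇ descentHeight c) +_) (+-identityʳ _) ⟩
    𝟙 (suc (suc h) ≤ᵇ descentHeight c) + 𝟙 (suc h ≡ᵇ descentHeight c)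
      ≡⟨ ≤ᵇ-split (suc h) (descentHeight c) ⟩
    𝟙 (suc h ≤ᵇ descentHeight c) ∎
    where open ≡-Reasoning

  -- Tight completions from the first U of an ascent at height h, with c + 1 boxes and one long
  -- ascent still to come: either this ascent becomes the long one, or it stays short and the
  -- count goes on after its box (boxThenOneLong).
  oneLongAhead : ℕ → ℕ → ℕ
  boxThenOneLong : ℕ → ℕ → ℕ
  oneLongAhead h zero = 𝟙 (suc h ≤ᵇ descentHeight 0)
  oneLongAhead h (suc c) = 𝟙 (suc h ≤ᵇ descentHeight (suc c)) + boxThenOneLong h c
  boxThenOneLong h c = if J + 2 ≤ᵇ h then oneLongAhead (h ∸ (J + 1)) c else 0

  oneLongAhead-vanishes : ∀ c h → descentHeight c ≤ h → oneLongAhead h c ≡ 0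
  oneLongAhead-vanishes zero h dh≤h rewrite >⇒≤ᵇ-false (s≤s dh≤h) = refl
  oneLongAhead-vanishes (suc c) h dh≤h rewrite >⇒≤ᵇ-false (s≤s dh≤h) with J + 2 ≤ᵇ h
  ... | false = refl
  ... | true = oneLongAhead-vanishes c (h ∸ (J + 1))
                 (m+n≤o⇒m≤o∸n (descentHeight c) (≤-trans (≤-reflexive (+-comm (descentHeight c) (J + 1))) dh≤h))

  above-box : ∀ h → suc (J + suc h) ∸ (J + 1) ≡ suc h
  above-box h = trans (cong (_∸ (J + 1)) (regroup j h)) (m+n∸m≡n (J + 1) (suc h))
    where
    regroup : ∀ j h → suc (suc j + suc h) ≡ suc j + 1 + suc h
    regroup = solve-∀

  room-for-box : ∀ h → J + 2 ≤ suc (J + suc h)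
  room-for-box h = ≤-trans (m≤m+n (J + 2) h) (≤-reflexive (regroup j h))
    where
    regroup : ∀ j h → suc j + 2 + h ≡ suc (suc j + suc h)
    regroup = solve-∀

  #-one-long-ahead : ∀ c N h → N + h ≡ 2 * need (just U) (inside J) c →
    #[ N ] just (ascent h c 1 1) ≡ oneLongAhead h c
  #-box-then-one-long : ∀ c N h → N + h ≡ 2 * need (just D) (inside j) (suc c) →
    #[ N ] just (inBox h (suc c) 1) ≡ boxThenOneLong (suc h) c

  #-one-long-ahead c zero h tight = trans
    (trans (#-zero _) (cong 𝟙 (accepts-[]-boxes-left (just U) h (inside J) c 1 1)))
    (sym (oneLongAhead-vanishes c h (<⇒≤ (subst (descentHeight c <_) (sym tight) (descentHeight<need c)))))
  #-one-long-ahead zero (suc N) zero tight =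
    trans (#-step N _ (#-last-long-ascent zero N 1 0 (trans (+-suc N 0) tight)) refl refl) (+-identityʳ _)
  #-one-long-ahead (suc c) (suc N) zero tight =
    #-step N _ (#-last-long-ascent (suc c) N 1 0 (trans (+-suc N 0) tight)) refl refl
  #-one-long-ahead zero (suc N) (suc h) tight = trans (#-step N _
    (#-last-long-ascent zero N (suc (suc h)) 0 (trans (+-suc N (suc h)) tight))
    (trans (#-last-box N h 1 (ascent-to-box N h zero tight)) (cong 𝟙 (∧-zeroʳ _)))
    refl) (+-identityʳ _)
  #-one-long-ahead (suc c) (suc N) (suc h) tight = trans (#-step N _
    (#-last-long-ascent (suc c) N (suc (suc h)) 0 (trans (+-suc N (suc h)) tight))
    (#-box-then-one-long c N h (ascent-to-box N h (suc c) tight))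
    refl) (cong (𝟙 (suc (suc h) ≤ᵇ descentHeight (suc c)) +_) (+-identityʳ _))

  #-box-then-one-long c N H tight with boxCase N H
  ... | low H≤J rewrite >⇒≤ᵇ-false {J + 2} {suc H} (s≤s (≤-trans (s≤s H≤J) (≤-reflexive (+-comm 2 j)))) =
    #-box-low N H c 1 H≤J tight
  ... | short h N≤J+1 rewrite ≤⇒≤ᵇ-true (room-for-box h) | above-box h =
    trans (#-box-short N h c 1 N≤J+1 tight)
      (sym (oneLongAhead-vanishes c (suc h) (≤-trans (short-above-descent N h c N≤J+1 tight) (n≤1+n h))))
  ... | fits h M refl rewrite ≤⇒≤ᵇ-true (room-for-box h) | above-box h =
    trans (#-box-then-ascent M h c 1 tight) (#-one-long-ahead c M (suc h) (box-to-ascent M h c tight))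

  #-first-long-ascent : ∀ c N h r → N + h ≡ 2 * need (just U) (inside J) (suc c) →
    #[ N ] just (ascent h (suc c) (suc (suc r)) 2) ≡ sumFrom (λ y → boxThenOneLong y c) h N
  #-first-long-ascent c zero h r _ =
    trans (#-zero _) (cong 𝟙 (accepts-[]-boxes-left (just U) h (inside J) (suc c) (suc (suc r)) 2))
  #-first-long-ascent c (suc N) zero r tight = trans (#-step N _
    (#-first-long-ascent c N 1 (suc r) (trans (+-suc N 0) tight)) refl refl) (+-identityʳ _)
  #-first-long-ascent c (suc N) (suc h) r tight = trans (#-step N _
    (#-first-long-ascent c N (suc (suc h)) (suc r) (trans (+-suc N (suc h)) tight))
    (#-box-then-one-long c N h (ascent-to-box N h (suc c) tight))
    refl) (trans (cong (sumFrom (λ y → boxThenOneLong y c) (suc (suc h)) N +_) (+-identityʳ _))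
                 (+-comm (sumFrom (λ y → boxThenOneLong y c) (suc (suc h)) N) (boxThenOneLong (suc h) c)))

  #-two-long-ascents : ∀ c N → suc (suc N) ≡ 2 * need (just U) (inside J) (suc c) →
    #[ suc (suc N) ] just (config nothing 0 outside (suc (suc c)) 0 2) ≡ sumFrom (λ y → boxThenOneLong y c) 2 N
  #-two-long-ascents c N tight = trans (#-step (suc N) _ (trans (#-step N _
    (#-first-long-ascent c N 2 0 (trans (+-comm N 2) tight))
    (#-box-low N 0 c 2 z≤n (ascent-to-box N 0 (suc c) (trans (+-comm (suc N) 1) tight)))
    refl) (+-identityʳ _)) refl refl) (+-identityʳ _)

  sum-boxThenOneLong : ∀ c M →
    sumFrom (λ y → boxThenOneLong y c) 1 (J + 1 + M) ≡ sumFrom (λ y → oneLongAhead y c) 1 M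
  sum-boxThenOneLong c M = begin
    sumFrom bp 1 (J + 1 + M)
      ≡⟨ sumFrom-++ bp 1 (J + 1) M ⟩
    sumFrom bp 1 (J + 1) + sumFrom bp (J + 1 + 1) M
      ≡⟨ cong (_+ sumFrom bp (J + 1 + 1) M) (sumFrom-vanishes bp 1 (J + 1) no-room) ⟩
    sumFrom bp (J + 1 + 1) M
      ≡⟨ sumFrom-shift bp (J + 1) 1 M ⟩
    sumFrom (λ x → bp (J + 1 + x)) 1 M
      ≡⟨ sumFrom-cong 1 M above ⟩
    sumFrom (λ y → oneLongAhead y c) 1 M ∎
    where
    open ≡-Reasoning
    bp : ℕ → ℕ
    bp y = boxThenOneLong y c
    no-room : ∀ x → 1 ≤ x → x < 1 + (J + 1) → bp x ≡ 0
    no-room x _ x<J+2 rewrite >⇒≤ᵇ-false {J + 2} {x} (subst (x <_) (cong suc (sym (+-suc j 1))) x<J+2) = refl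
    above : ∀ x → 1 ≤ x → bp (J + 1 + x) ≡ oneLongAhead x c
    above x 1≤x rewrite ≤⇒≤ᵇ-true (≤-trans (≤-reflexive (sym (+-assoc J 1 1))) (+-monoʳ-≤ (J + 1) 1≤x))
      = cong (λ y → oneLongAhead y c) (m+n∸m≡n (J + 1) x)

  sum-oneLongAhead : ∀ c M → descentHeight c ≤ suc M →
    2 * sumFrom (λ y → oneLongAhead y c) 1 M + 2 * suc c ≡ suc c * suc (suc c) * (J + 1)
  sum-oneLongAhead zero M dh≤ = begin
    2 * sumFrom (λ y → 𝟙 (suc y ≤ᵇ descentHeight 0)) 1 M + 2 * 1
      ≡⟨ *-distribˡ-+ 2 (sumFrom (λ y → 𝟙 (suc y ≤ᵇ descentHeight 0)) 1 M) 1 ⟨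
    2 * (sumFrom (λ y → 𝟙 (suc y ≤ᵇ descentHeight 0)) 1 M + 1)
      ≡⟨ cong (2 *_) (sumFrom-indicator (descentHeight 0) 1 M (s≤s z≤n) dh≤) ⟩
    2 * descentHeight 0
      ≡⟨ expand j ⟩
    1 * 2 * (J + 1) ∎
    where
    open ≡-Reasoning
    expand : ∀ j → 2 * (1 * (suc j + 1)) ≡ 1 * 2 * (suc j + 1)
    expand = solve-∀
  sum-oneLongAhead (suc c) M dh≤ =
    subst Claim (m+[n∸m]≡n J+1≤M) (after-first-box (M ∸ (J + 1)) (+-cancelˡ-≤ (J + 1) _ _ dh≤′))
    where
    open ≡-Reasoning
    Claim : ℕ → Set
    Claim m = 2 * sumFrom (λ y → oneLongAhead y (suc c)) 1 m + 2 * suc (suc c) ≡ suc (suc c) * suc (suc (suc c)) * (J + 1)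
    J+1≤M : J + 1 ≤ M
    J+1≤M = ≤-pred (≤-trans (≤-reflexive (+-comm 1 (J + 1))) (≤-trans (+-monoʳ-≤ (J + 1) (s≤s z≤n)) dh≤))
    dh≤′ : J + 1 + descentHeight c ≤ J + 1 + suc (M ∸ (J + 1))
    dh≤′ = ≤-trans dh≤
      (≤-reflexive (trans (cong suc (sym (m+[n∸m]≡n J+1≤M))) (sym (+-suc (J + 1) (M ∸ (J + 1))))))
    after-first-box : ∀ M′ → descentHeight c ≤ suc M′ → Claim (J + 1 + M′)
    after-first-box M′ le = begin
      2 * sumFrom (λ y → indicator y + boxThenOneLong y c) 1 (J + 1 + M′) + 2 * suc (suc c)
        ≡⟨ cong (λ s → 2 * s + 2 * suc (suc c)) (sumFrom-+ indicator (λ y → boxThenOneLong y c) 1 (J + 1 + M′)) ⟩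
      2 * (I + sumFrom (λ y → boxThenOneLong y c) 1 (J + 1 + M′)) + 2 * suc (suc c)
        ≡⟨ cong (λ s → 2 * (I + s) + 2 * suc (suc c)) (sum-boxThenOneLong c M′) ⟩
      2 * (I + S) + 2 * suc (suc c)
        ≡⟨ regroup I S c ⟩
      2 * (I + 1) + (2 * S + 2 * suc c)
        ≡⟨ cong₂ (λ a b → 2 * a + b) (sumFrom-indicator (descentHeight (suc c)) 1 (J + 1 + M′) (s≤s z≤n) bound)
                                     (sum-oneLongAhead c M′ le) ⟩
      2 * descentHeight (suc c) + suc c * suc (suc c) * (J + 1)
        ≡⟨ closed j c ⟩
      suc (suc c) * suc (suc (suc c)) * (J + 1) ∎
      where
      indicator : ℕ → ℕ
      indicator y = 𝟙 (suc y ≤ᵇ descentHeight (suc c))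
      I S : ℕ
      I = sumFrom indicator 1 (J + 1 + M′)
      S = sumFrom (λ y → oneLongAhead y c) 1 M′
      bound : descentHeight (suc c) ≤ 1 + (J + 1 + M′)
      bound = ≤-trans (+-monoʳ-≤ (J + 1) le) (≤-reflexive (+-suc (J + 1) M′))
      regroup : ∀ I S c → 2 * (I + S) + 2 * suc (suc c) ≡ 2 * (I + 1) + (2 * S + 2 * suc c)
      regroup = solve-∀
      closed : ∀ j c → 2 * (suc (suc c) * (suc j + 1)) + suc c * suc (suc c) * (suc j + 1)
                       ≡ suc (suc c) * suc (suc (suc c)) * (suc j + 1)
      closed = solve-∀

  two-long-ascents-count : ∀ c → 2 * countTwoLong J (suc c + 1) ≡ suc c * ((J + 1) * suc c + j)
  two-long-ascents-count c = +-cancelʳ-≡ (2 * suc c) _ _ (begin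
    2 * countTwoLong J (suc c + 1) + 2 * suc c  ≡⟨ cong (λ n → 2 * n + 2 * suc c) count≡sum ⟩
    2 * sumFrom (λ y → oneLongAhead y c) 1 M′ + 2 * suc c  ≡⟨ sum-oneLongAhead c M′ enough ⟩
    suc c * suc (suc c) * (J + 1)                ≡⟨ closed j c ⟨
    suc c * ((J + 1) * suc c + j) + 2 * suc c    ∎)
    where
    open ≡-Reasoning
    len N M′ : ℕ
    len = 2 * ((J + 2) * (suc c + 1) ∸ 1)
    N = 2 * (suc c * (J + 2) + J)
    M′ = 2 * (suc c * (J + 2)) + J
    closed : ∀ j c → suc c * ((suc j + 1) * suc c + j) + 2 * suc c ≡ suc c * suc (suc c) * (suc j + 1)
    closed = solve-∀
    len≡N+2 : len ≡ suc (suc N)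
    len≡N+2 = trans (cong (λ x → 2 * (x ∸ 1)) (size j c))
      (trans (cong (2 *_) (m+n∸m≡n 1 (suc c * (J + 2) + J + 1))) (double j c))
      where
      size : ∀ j c → (suc j + 2) * (suc c + 1) ≡ 1 + (suc c * (suc j + 2) + suc j + 1)
      size = solve-∀
      double : ∀ j c → 2 * (suc c * (suc j + 2) + suc j + 1) ≡ suc (suc (2 * (suc c * (suc j + 2) + suc j)))
      double = solve-∀
    tight : suc (suc N) ≡ 2 * need (just U) (inside J) (suc c)
    tight = expand j c
      where
      expand : ∀ j c → suc (suc (2 * (suc c * (suc j + 2) + suc j))) ≡ 2 * (suc c * (suc j + 2) + suc j + 1 + 0)
      expand = solve-∀
    N+1≡J+1+M′ : suc N ≡ J + 1 + M′
    N+1≡J+1+M′ = expand j c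
      where
      expand : ∀ j c → suc (2 * (suc c * (suc j + 2) + suc j)) ≡ suc j + 1 + (2 * (suc c * (suc j + 2)) + suc j)
      expand = solve-∀
    enough : descentHeight c ≤ suc M′
    enough = ≤-trans (m≤m+n (descentHeight c) (suc c * (j + 4) + j + 2)) (≤-reflexive (expand j c))
      where
      expand : ∀ j c → suc c * (suc j + 1) + (suc c * (j + 4) + j + 2) ≡ suc (2 * (suc c * (suc j + 2)) + suc j)
      expand = solve-∀
    first-box-too-high : boxThenOneLong 1 c ≡ 0
    first-box-too-high rewrite >⇒≤ᵇ-false {J + 2} {1} (m≤n+m 2 J) = refl
    count≡sum : countTwoLong J (suc c + 1) ≡ sumFrom (λ y → oneLongAhead y c) 1 M′
    count≡sum = begin
      countTwoLong J (suc c + 1)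
        ≡⟨ countᵇ-filterᵇ (λ w → longAscents w ≡ᵇ 2)
                          (λ w → isSkewDyck w ∧ (occurrences (boxFactor J) w ≡ᵇ (suc c + 1))) (words len) ⟩
      countᵇ (accepts (config nothing 0 outside (suc c + 1) 0 2)) (words len)
        ≡⟨ #accepted-words len (config nothing 0 outside (suc c + 1) 0 2) ⟨
      #[ len ] just (config nothing 0 outside (suc c + 1) 0 2)
        ≡⟨ cong₂ (λ n m → #[ n ] just (config nothing 0 outside m 0 2)) len≡N+2 (+-comm (suc c) 1) ⟩
      #[ suc (suc N) ] just (config nothing 0 outside (suc (suc c)) 0 2)
        ≡⟨ #-two-long-ascents c N tight ⟩
      sumFrom (λ y → boxThenOneLong y c) 2 N
        ≡⟨ cong (_+ sumFrom (λ y → boxThenOneLong y c) 2 N) first-box-too-high ⟨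
      sumFrom (λ y → boxThenOneLong y c) 1 (suc N)
        ≡⟨ cong (sumFrom (λ y → boxThenOneLong y c) 1) N+1≡J+1+M′ ⟩
      sumFrom (λ y → boxThenOneLong y c) 1 (J + 1 + M′)
        ≡⟨ sum-boxThenOneLong c M′ ⟩
      sumFrom (λ y → oneLongAhead y c) 1 M′ ∎

theorem7p4 : (k n : ℕ) → 3 ≤ k → 1 ≤ n →
    2 * countTwoLong (k ∸ 3) (n + 1) ≡ n * (((k ∸ 2) * n + k) ∸ 4)
theorem7p4 (suc (suc (suc zero))) (suc c) (s≤s (s≤s (s≤s z≤n))) (s≤s z≤n) =
  trans (ZeroBox.two-peaks-count c) (cong (suc c *_) (sym (trans (cong (_∸ 4) (regroup c)) (m+n∸m≡n 4 c))))
  where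
  regroup : ∀ c → 1 * suc c + 3 ≡ 4 + c
  regroup = solve-∀
theorem7p4 (suc (suc (suc (suc j)))) (suc c) (s≤s (s≤s (s≤s z≤n))) (s≤s z≤n) =
  trans (Boxes.two-long-ascents-count j c) (cong (suc c *_) (sym (trans (cong (_∸ 4) (regroup j c)) (m+n∸m≡n 4 _))))
  where
  regroup : ∀ j c → suc (suc j) * suc c + suc (suc (suc (suc j))) ≡ 4 + ((suc j + 1) * suc c + j)
  regroup = solve-∀
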